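{- Let $K$ be a finite set of positive integers and $k_{\max}=\max K$. Suppose that there exist: (1) a $(u\times v,g\times h,K,1)$-BDP; (2) an $(m,k_{\max};1)$-CDM; (3) a $(g\times mh,s\times t,K,1)$-BDP. Then there exist a $(u\times mv,s\times t,K,1)$-BDP and a $(u\times mv,g\times mh,K,1)$-BDP. Likewise, if (1) and (2) hold and there exists an $(mg\times h,s\times t,K,1)$-BDP, then there exist an $(mu\times v,s\times t,K,1)$-BDP and an $(mu\times v,mg\times h,K,1)$-BDP.
   Context: Let $G$ be a finite additive group and $K$ a set of positive integers. For $C\subseteq G$, $\Delta C$ denotes the multiset of all differences $x-y$ with $(x,y)$ an ordered pair of distinct elements of $C$. A $(G,K,1)$ difference packing is a set $\mathcal B$ of subsets of $G$ (blocks), each of size in $K$, such that the multiset $\bigcup_{B\in\mathcal B}\Delta B$ contains every element of $G$ at most once; its difference leave is the set of elements of $G$ not occurring in this multiset. It is balanced (BDP) if the number of blocks of size $k$ is the same for every $k\in K$. For $s\mid u$ and $t\mid v$, a $(u\times v,s\times t,K,1)$-BDP is a balanced $(Z_u\times Z_v,K,1)$ difference packing whose difference leave is exactly the subgroup $(u/s)Z_u\times (v/t)Z_v$. For an additive group $A$ of order $n$, a $(A,k;1)$ difference matrix is a $k\times n$ matrix $(d_{ij})$ with entries in $A$ such that for any two distinct rows $i\neq j$ the multiset $[d_{il}-d_{jl}:0\le l\le n-1]$ contains every element of $A$ exactly once; an $(m,k;1)$-CDM is a $(Z_m,k;1)$ difference matrix. -}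

module Defs where

open import Data.Nat using (ℕ; zero; suc; _+_; _*_; _∸_; _≤_; _<_; _⊔_; _≟_)
open import Data.Nat.DivMod using (_%_; _/_)
open import Data.Nat.Divisibility using (_∣_)
open import Data.Product using (_×_; _,_; Σ; Σ-syntax)
open import Data.Product.Properties using (≡-dec)
open import Data.List using (List; []; _∷_; length; map; concatMap; filter; foldr)
open import Data.List.Membership.Propositional using (_∈_; _∉_)
open import Data.List.Relation.Unary.All using (All)
open import Data.List.Relation.Unary.Unique.Propositional using (Unique)
open import Data.Fin using (Fin)
open import Data.List using (allFin)
open import Relation.Binary.PropositionalEquality using (_≡_; _≢_)
open import Relation.Nullary using (yes; no; Dec)
open import Function.Bundles using (_⇔_)

-- Reduction modulo n (only used for n ≥ 1; the n = 0 case is a dummy value).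
modN : ℕ → ℕ → ℕ
modN a zero    = a
modN a (suc n) = a % suc n

-- Division (only used for divisor ≥ 1; dummy value for divisor 0).
divN : ℕ → ℕ → ℕ
divN a zero    = zero
divN a (suc n) = a / suc n

-- Subtraction in Z_n on representatives 0..n-1.
subZ : ℕ → ℕ → ℕ → ℕ
subZ n a b = modN (a + (n ∸ b)) n

-- Elements of Z_u × Z_v are pairs of representatives (x , y), x < u, y < v.
Elt : Set
Elt = ℕ × ℕ

InG : ℕ → ℕ → Elt → Set
InG u v (x , y) = (x < u) × (y < v)

subG : ℕ → ℕ → Elt → Elt → Elt
subG u v (x₁ , y₁) (x₂ , y₂) = (subZ u x₁ x₂ , subZ v y₁ y₂)

_≟E_ : (a b : Elt) → Dec (a ≡ b)
_≟E_ = ≡-dec _≟_ _≟_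

Δ : ℕ → ℕ → List Elt → List Elt
Δ u v B = concatMap (λ x → concatMap (λ y → diffIf x y) B) B
  where
  diffIf : Elt → Elt → List Elt
  diffIf x y with x ≟E y
  ... | yes _ = []
  ... | no  _ = subG u v x y ∷ []

allDiffs : ℕ → ℕ → List (List Elt) → List Elt
allDiffs u v 𝓑 = concatMap (Δ u v) 𝓑

numBlocks : ℕ → List (List Elt) → ℕ
numBlocks k 𝓑 = length (filter (λ B → length B ≟ k) 𝓑)

InH : ℕ → ℕ → ℕ → ℕ → Elt → Set
InH u v s t (x , y) = (divN u s ∣ x) × (divN v t ∣ y)

-- A (u × v, s × t, K, 1)-BDP.  The blocks form a set (no repeated block);
-- each block is a set (no repeated element) of elements of Z_u × Z_v of size in K.
record BDP (u v s t : ℕ) (K : List ℕ) : Set where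
  field
    u-pos    : 1 ≤ u
    v-pos    : 1 ≤ v
    s∣u      : s ∣ u
    t∣v      : t ∣ v
    blocks   : List (List Elt)
    blocks-distinct : Unique blocks
    block-elts : All (λ B → All (InG u v) B) blocks
    block-set  : All Unique blocks
    block-size : All (λ B → length B ∈ K) blocks
    packing  : Unique (allDiffs u v blocks)
    balanced : ∀ {k k'} → k ∈ K → k' ∈ K → numBlocks k blocks ≡ numBlocks k' blocks
    leave    : ∀ g → InG u v g → (g ∉ allDiffs u v blocks) ⇔ InH u v s t g

record CDM (m k : ℕ) : Set where
  field
    m-pos   : 1 ≤ m
    entry   : Fin k → Fin m → ℕ
    entry<m : ∀ i l → entry i l < m
    diffRow : ∀ i j → i ≢ j → ∀ a → a < m →
              length (filter (_≟ a) (map (λ l → subZ m (entry i l) (entry j l)) (allFin m))) ≡ 1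

kmax : List ℕ → ℕ
kmax K = foldr _⊔_ 0 K

-- A family of blocks has difference leave H exactly when every element of the group outside
-- H occurs once among its differences and no element of H occurs, so everything is argued
-- on occurrence counts.  Lifting: each block {b₀, …, b_{n-1}} of a (u × v, g × h) BDP yields,
-- for every column l of the CDM (dᵢₗ), the block {bᵢ + (0, v·dᵢₗ)} of Z_u × Z_{mv}.  Read in
-- base v, a difference of two lifted points has the old difference as low digit and
-- dᵢₗ − dⱼₗ plus a carry as high digit; as two rows of the CDM differ by each value in exactly
-- one column, the lifted blocks form a (u × mv, g × mh) BDP.  Filling: a (g × mh, s × t) BDP,
-- scaled into the leave (u/g)Z_u × (v/h)Z_{mv} ≅ Z_g × Z_{mh}, covers all of it except
-- (u/s)Z_u × (mv/t)Z_{mv}.  The second half is the first with the coordinates swapped.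

module Submission where

open import Defs
open import Data.Empty using (⊥-elim)
open import Data.Fin using (Fin; toℕ; fromℕ<)
open import Data.Fin.Properties using (toℕ-fromℕ<)
open import Data.List using (List; []; _∷_; _++_; [_]; length; map; concatMap; filter; allFin)
open import Data.List.Properties using (length-tabulate; filter-++; filter-all; filter-none; length-++; length-map; concatMap-++; ++-identityʳ)
open import Data.List.Membership.Propositional using (_∈_; _∉_; find)
open import Data.List.Membership.Propositional.Properties using (∈-map⁻)
open import Data.List.Relation.Unary.Any as Any using (here; there; any?)
open import Data.List.Relation.Unary.All as All using (All; []; _∷_; tabulate; lookup)
import Data.List.Relation.Unary.All.Properties as Allₚ
open import Data.List.Relation.Unary.AllPairs using ([]; _∷_)
open import Data.List.Relation.Unary.Unique.Propositional using (Unique)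
import Data.List.Relation.Unary.Unique.Propositional.Properties as Uniqueₚ
open import Data.Nat using (ℕ; suc; _+_; _*_; _∸_; _≤_; _<_; _≟_; _≤?_; _<?_; z≤n; s≤s; NonZero; >-nonZero; >-nonZero⁻¹)
open import Data.Nat.DivMod using (_%_; _/_; %-congʳ; %-distribˡ-+; m%n%n≡m%n; [m+n]%n≡m%n; [m+kn]%n≡m%n; m<n⇒m%n≡m; m≡m%n+[m/n]*n; m%n<n; m%n*o≡m*o%[n*o]; m*n/n≡m)
open import Data.Nat.Divisibility using (_∣_; _∣?_; divides; ∣-trans; *-monoʳ-∣; *-cancelˡ-∣; m∣m*n; %-presˡ-∣; ∣n∣m%n⇒∣m)
open import Data.Nat.Properties
open import Algebra.Properties.CommutativeSemigroup +-commutativeSemigroup using () renaming (interchange to +-interchange)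
open import Data.Nat.Solver using (module +-*-Solver)
open import Data.List.Membership.DecPropositional _≟E_ using (_∈?_)
open import Data.List.Membership.DecPropositional _≟_ using () renaming (_∈?_ to _∈ℕ?_)
open import Data.Product using (Σ; _×_; _,_; proj₁; proj₂) renaming (swap to ×-swap)
open import Data.Product.Properties using (,-injectiveˡ; ,-injectiveʳ)
open import Data.Product.Function.NonDependent.Propositional using (_×-⇔_)
open import Function using (_∘′_; id)
open import Function.Bundles using (_⇔_; mk⇔; Equivalence)
import Function.Properties.Equivalence as ⇔
open import Level using (Level)
open import Relation.Binary.PropositionalEquality hiding ([_])
open import Relation.Nullary using (¬_; Dec; yes; no)
open import Relation.Nullary.Decidable using (_×-dec_; ¬?; decidable-stable)
open import Relation.Unary using (Pred; Decidable)

open +-*-Solver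

private variable
  a p q : Level
  A B : Set a
  P : Set p
  Q : Set q

𝟙 : Dec P → ℕ
𝟙 (yes _) = 1
𝟙 (no _)  = 0

𝟙-yes : P → (d : Dec P) → 𝟙 d ≡ 1
𝟙-yes _  (yes _) = refl
𝟙-yes p (no ¬p) = ⊥-elim (¬p p)

𝟙-no : ¬ P → (d : Dec P) → 𝟙 d ≡ 0
𝟙-no ¬p (yes p) = ⊥-elim (¬p p)
𝟙-no _  (no _)  = refl

𝟙≤1 : (d : Dec P) → 𝟙 d ≤ 1
𝟙≤1 (yes _) = ≤-refl
𝟙≤1 (no _)  = z≤n

𝟙-cong : (P → Q) → (Q → P) → (d : Dec P) (d′ : Dec Q) → 𝟙 d ≡ 𝟙 d′
𝟙-cong f g (yes p) d′ = sym (𝟙-yes (f p) d′)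
𝟙-cong f g (no ¬p) d′ = sym (𝟙-no (λ q → ¬p (g q)) d′)

𝟙-×-dec : (d : Dec P) (d′ : Dec Q) → 𝟙 (d ×-dec d′) ≡ 𝟙 d * 𝟙 d′
𝟙-×-dec (yes _) (yes _) = refl
𝟙-×-dec (yes _) (no _)  = refl
𝟙-×-dec (no _)  _       = refl

∑ : (A → ℕ) → List A → ℕ
∑ f []       = 0
∑ f (x ∷ xs) = f x + ∑ f xs

∑-cong : {f g : A → ℕ} (xs : List A) → (∀ {x} → x ∈ xs → f x ≡ g x) → ∑ f xs ≡ ∑ g xs
∑-cong []       _  = refl
∑-cong (x ∷ xs) eq = cong₂ _+_ (eq (here refl)) (∑-cong xs (λ m → eq (there m)))

∑-zero : {f : A → ℕ} (xs : List A) → (∀ {x} → x ∈ xs → f x ≡ 0) → ∑ f xs ≡ 0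
∑-zero []       _  = refl
∑-zero (x ∷ xs) eq = cong₂ _+_ (eq (here refl)) (∑-zero xs (λ m → eq (there m)))

∑-mono-≤ : {f g : A → ℕ} (xs : List A) → (∀ {x} → x ∈ xs → f x ≤ g x) → ∑ f xs ≤ ∑ g xs
∑-mono-≤ []       _  = z≤n
∑-mono-≤ (x ∷ xs) le = +-mono-≤ (le (here refl)) (∑-mono-≤ xs (λ m → le (there m)))

term≤∑ : (f : A → ℕ) {x : A} (xs : List A) → x ∈ xs → f x ≤ ∑ f xs
term≤∑ f (y ∷ xs) (here refl) = m≤m+n (f y) _
term≤∑ f (y ∷ xs) (there m)   = ≤-trans (term≤∑ f xs m) (m≤n+m _ (f y))

∑-++ : (f : A → ℕ) (xs ys : List A) → ∑ f (xs ++ ys) ≡ ∑ f xs + ∑ f ys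
∑-++ f []       ys = refl
∑-++ f (x ∷ xs) ys = trans (cong (f x +_) (∑-++ f xs ys)) (sym (+-assoc (f x) _ _))

∑-map : (f : B → ℕ) (g : A → B) (xs : List A) → ∑ f (map g xs) ≡ ∑ (λ x → f (g x)) xs
∑-map f g []       = refl
∑-map f g (x ∷ xs) = cong (f (g x) +_) (∑-map f g xs)

∑-concatMap : (f : B → ℕ) (g : A → List B) (xs : List A) →
              ∑ f (concatMap g xs) ≡ ∑ (λ x → ∑ f (g x)) xs
∑-concatMap f g []       = refl
∑-concatMap f g (x ∷ xs) =
  trans (∑-++ f (g x) (concatMap g xs)) (cong (∑ f (g x) +_) (∑-concatMap f g xs))

∑-+ : (f g : A → ℕ) (xs : List A) → ∑ (λ x → f x + g x) xs ≡ ∑ f xs + ∑ g xs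
∑-+ f g []       = refl
∑-+ f g (x ∷ xs) = trans (cong (f x + g x +_) (∑-+ f g xs)) (+-interchange (f x) (g x) _ _)

∑-*ˡ : (c : ℕ) (f : A → ℕ) (xs : List A) → ∑ (λ x → c * f x) xs ≡ c * ∑ f xs
∑-*ˡ c f []       = sym (*-zeroʳ c)
∑-*ˡ c f (x ∷ xs) = trans (cong (c * f x +_) (∑-*ˡ c f xs)) (sym (*-distribˡ-+ c (f x) _))

∑-const : ∀ c (xs : List A) → ∑ (λ _ → c) xs ≡ length xs * c
∑-const c []       = refl
∑-const c (x ∷ xs) = cong (c +_) (∑-const c xs)

∑-comm : (f : A → B → ℕ) (xs : List A) (ys : List B) →
         ∑ (λ x → ∑ (f x) ys) xs ≡ ∑ (λ y → ∑ (λ x → f x y) xs) ys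
∑-comm f []       ys = sym (∑-zero ys (λ _ → refl))
∑-comm f (x ∷ xs) ys =
  trans (cong (∑ (f x) ys +_) (∑-comm f xs ys)) (sym (∑-+ (f x) (λ y → ∑ (λ x → f x y) xs) ys))

module _ {A : Set a} {P : Pred A p} (P? : Decidable P) where

  length-filter≡∑𝟙 : (xs : List A) → length (filter P? xs) ≡ ∑ (λ x → 𝟙 (P? x)) xs
  length-filter≡∑𝟙 []       = refl
  length-filter≡∑𝟙 (x ∷ xs) with P? x
  ... | yes _ = cong suc (length-filter≡∑𝟙 xs)
  ... | no  _ = length-filter≡∑𝟙 xs

  ∑-filter-≤ : (f : A → ℕ) (xs : List A) → ∑ f (filter P? xs) ≤ ∑ f xs
  ∑-filter-≤ f []       = z≤n
  ∑-filter-≤ f (x ∷ xs) with P? x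
  ... | yes _ = +-monoʳ-≤ (f x) (∑-filter-≤ f xs)
  ... | no  _ = ≤-trans (∑-filter-≤ f xs) (m≤n+m _ (f x))

  ∑-filter : (f : A → ℕ) → (∀ x → ¬ P x → f x ≡ 0) → (xs : List A) → ∑ f (filter P? xs) ≡ ∑ f xs
  ∑-filter f f≡0 []       = refl
  ∑-filter f f≡0 (x ∷ xs) with P? x
  ... | yes _  = cong (f x +_) (∑-filter f f≡0 xs)
  ... | no ¬px = trans (∑-filter f f≡0 xs) (cong (_+ ∑ f xs) (sym (f≡0 x ¬px)))

occ : Elt → List Elt → ℕ
occ e = ∑ (λ x → 𝟙 (e ≟E x))

∉⇒occ≡0 : ∀ {e} xs → e ∉ xs → occ e xs ≡ 0
∉⇒occ≡0 xs e∉ = ∑-zero xs (λ x∈ → 𝟙-no (λ { refl → e∉ x∈ }) _)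

∈⇒1≤occ : ∀ {e} xs → e ∈ xs → 1 ≤ occ e xs
∈⇒1≤occ {e} xs e∈ = ≤-trans (≤-reflexive (sym (𝟙-yes refl (e ≟E e)))) (term≤∑ (λ x → 𝟙 (e ≟E x)) xs e∈)

1≤occ⇒∈ : ∀ {e} xs → 1 ≤ occ e xs → e ∈ xs
1≤occ⇒∈ {e} (x ∷ xs) 1≤ with e ≟E x
... | yes refl = here refl
... | no  _    = there (1≤occ⇒∈ xs 1≤)

Unique⇒occ≤1 : ∀ e xs → Unique xs → occ e xs ≤ 1
Unique⇒occ≤1 e []       _        = z≤n
Unique⇒occ≤1 e (x ∷ xs) uniq@(_ ∷ u) with e ≟E x
... | yes refl = ≤-reflexive (cong suc (∉⇒occ≡0 xs (Uniqueₚ.Unique[x∷xs]⇒x∉xs uniq)))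
... | no  _    = Unique⇒occ≤1 e xs u

occ≤1⇒Unique : ∀ xs → (∀ e → occ e xs ≤ 1) → Unique xs
occ≤1⇒Unique []       _  = []
occ≤1⇒Unique (x ∷ xs) le =
  tabulate (λ y∈ x≡y → x∉xs (subst (_∈ xs) (sym x≡y) y∈)) ∷ occ≤1⇒Unique xs (λ e → ≤-trans (m≤n+m _ _) (le e))
  where
  x∉xs : x ∉ xs
  x∉xs x∈ = <⇒≱ (s≤s (∈⇒1≤occ xs x∈)) (subst (_≤ 1) (cong (_+ occ x xs) (𝟙-yes refl (x ≟E x))) (le x))

diffOcc : ℕ → ℕ → Elt → Elt → Elt → ℕ
diffOcc u v e x y with x ≟E y
... | yes _ = 0
... | no  _ = 𝟙 (e ≟E subG u v x y)

diffOcc-≡ : ∀ u v e {x y} → x ≡ y → diffOcc u v e x y ≡ 0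
diffOcc-≡ u v e {x} {y} x≡y with x ≟E y
... | yes _   = refl
... | no x≢y = ⊥-elim (x≢y x≡y)

diffOcc-≢ : ∀ u v e {x y} → x ≢ y → diffOcc u v e x y ≡ 𝟙 (e ≟E subG u v x y)
diffOcc-≢ u v e {x} {y} x≢y with x ≟E y
... | yes x≡y = ⊥-elim (x≢y x≡y)
... | no _    = refl

-- The pair function of Δ is local to its definition; this exposes it.
Δ-pairs : ∀ u v B → Σ (Elt → Elt → List Elt) λ D → Δ u v B ≡ concatMap (λ x → concatMap (D x) B) B
Δ-pairs u v B = _ , refl

occ-Δ : ∀ u v e B → occ e (Δ u v B) ≡ ∑ (λ x → ∑ (diffOcc u v e x) B) B
occ-Δ u v e B =
  trans (∑-concatMap _ _ B) (∑-cong B λ {x} _ → trans (∑-concatMap _ _ B) (∑-cong B λ {y} _ → occ-pair x y))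
  where
  occ-pair : ∀ x y → occ e (proj₁ (Δ-pairs u v B) x y) ≡ diffOcc u v e x y
  occ-pair x y with x ≟E y
  ... | yes _ = refl
  ... | no  _ = +-identityʳ _

occ-allDiffs : ∀ u v e 𝓑 → occ e (allDiffs u v 𝓑) ≡ ∑ (λ B → occ e (Δ u v B)) 𝓑
occ-allDiffs u v e = ∑-concatMap _ (Δ u v)

occ-allDiffs-++ : ∀ u v e 𝓑 𝓒 → occ e (allDiffs u v (𝓑 ++ 𝓒)) ≡ occ e (allDiffs u v 𝓑) + occ e (allDiffs u v 𝓒)
occ-allDiffs-++ u v e 𝓑 𝓒 = trans (cong (occ e) (concatMap-++ (Δ u v) 𝓑 𝓒)) (∑-++ _ (allDiffs u v 𝓑) _)

occ-Δ-map : ∀ U V e (f : A → Elt) xs → occ e (Δ U V (map f xs)) ≡ ∑ (λ a → ∑ (λ b → diffOcc U V e (f a) (f b)) xs) xs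
occ-Δ-map U V e f xs = begin
  occ e (Δ U V (map f xs))                                 ≡⟨ occ-Δ U V e (map f xs) ⟩
  ∑ (λ x → ∑ (diffOcc U V e x) (map f xs)) (map f xs)      ≡⟨ ∑-map _ f xs ⟩
  ∑ (λ a → ∑ (diffOcc U V e (f a)) (map f xs)) xs          ≡⟨ ∑-cong xs (λ {a} _ → ∑-map _ f xs) ⟩
  ∑ (λ a → ∑ (λ b → diffOcc U V e (f a) (f b)) xs) xs      ∎
  where open ≡-Reasoning

subZ-< : ∀ n a b → 1 ≤ n → subZ n a b < n
subZ-< (suc n) a b _ = m%n<n (a + (suc n ∸ b)) (suc n)

subG-InG : ∀ {u v} x y → 1 ≤ u → 1 ≤ v → InG u v (subG u v x y)
subG-InG (x₁ , y₁) (x₂ , y₂) 1≤u 1≤v = subZ-< _ x₁ x₂ 1≤u , subZ-< _ y₁ y₂ 1≤v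

occ-allDiffs-outside : ∀ {u v e} 𝓑 → 1 ≤ u → 1 ≤ v → ¬ InG u v e → occ e (allDiffs u v 𝓑) ≡ 0
occ-allDiffs-outside {u} {v} {e} 𝓑 1≤u 1≤v e∉G =
  trans (occ-allDiffs u v e 𝓑) (∑-zero 𝓑 λ {B} _ →
    trans (occ-Δ u v e B) (∑-zero B λ {x} _ → ∑-zero B λ {y} _ → diffOcc-outside x y))
  where
  diffOcc-outside : ∀ x y → diffOcc u v e x y ≡ 0
  diffOcc-outside x y with x ≟E y
  ... | yes _ = refl
  ... | no  _ = 𝟙-no (λ { refl → e∉G (subG-InG x y 1≤u 1≤v) }) _

InG? : ∀ u v e → Dec (InG u v e)
InG? u v (x , y) = (x <? u) ×-dec (y <? v)

InH? : ∀ u v s t e → Dec (InH u v s t e)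
InH? u v s t (x , y) = (divN u s ∣? x) ×-dec (divN v t ∣? y)

HasLeave : ℕ → ℕ → ℕ → ℕ → List Elt → Set
HasLeave u v s t L = ∀ e → InG u v e → occ e L ≡ 𝟙 (¬? (InH? u v s t e))

HasLeave⇒Unique : ∀ {u v} s t 𝓑 → 1 ≤ u → 1 ≤ v → HasLeave u v s t (allDiffs u v 𝓑) → Unique (allDiffs u v 𝓑)
HasLeave⇒Unique {u} {v} s t 𝓑 1≤u 1≤v leave = occ≤1⇒Unique _ occ≤1
  where
  occ≤1 : ∀ e → occ e (allDiffs u v 𝓑) ≤ 1
  occ≤1 e with InG? u v e
  ... | yes e∈G = ≤-trans (≤-reflexive (leave e e∈G)) (𝟙≤1 _)
  ... | no  e∉G = ≤-trans (≤-reflexive (occ-allDiffs-outside 𝓑 1≤u 1≤v e∉G)) z≤n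

HasLeave⇒leave : ∀ {u v} s t {L} → HasLeave u v s t L → ∀ g → InG u v g → (g ∉ L) ⇔ InH u v s t g
HasLeave⇒leave {u} {v} s t {L} leave g g∈G = mk⇔ to from
  where
  to : g ∉ L → InH u v s t g
  to g∉L = decidable-stable (InH? u v s t g) λ g∉H →
    g∉L (1≤occ⇒∈ L (≤-reflexive (sym (trans (leave g g∈G) (𝟙-yes g∉H _)))))
  from : InH u v s t g → g ∉ L
  from g∈H g∈L = <⇒≱ (∈⇒1≤occ L g∈L) (≤-reflexive (trans (leave g g∈G) (𝟙-no (λ g∉H → g∉H g∈H) _)))

packing-leave⇒HasLeave : ∀ {u v s t L} → Unique L → (∀ g → InG u v g → (g ∉ L) ⇔ InH u v s t g) → HasLeave u v s t L
packing-leave⇒HasLeave {u} {v} {s} {t} {L} uniq leave e e∈G with InH? u v s t e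
... | yes e∈H = ∉⇒occ≡0 L (Equivalence.from (leave e e∈G) e∈H)
... | no  e∉H = ≤-antisym (Unique⇒occ≤1 e L uniq)
                  (∈⇒1≤occ L (decidable-stable (e ∈? L) λ e∉L → e∉H (Equivalence.to (leave e e∈G) e∉L)))

numBlocks≡∑ : ∀ k 𝓑 → numBlocks k 𝓑 ≡ ∑ (λ B → 𝟙 (length B ≟ k)) 𝓑
numBlocks≡∑ k = length-filter≡∑𝟙 (λ B → length B ≟ k)

occ-Δ-small : ∀ u v e B → ¬ 2 ≤ length B → occ e (Δ u v B) ≡ 0
occ-Δ-small u v e []      _ = refl
occ-Δ-small u v e (x ∷ []) _ = trans (occ-Δ u v e (x ∷ [])) (cong (λ n → n + 0 + 0) (diffOcc-≡ u v e {x} refl))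
occ-Δ-small u v e (_ ∷ _ ∷ _) ¬2≤ = ⊥-elim (¬2≤ (s≤s (s≤s z≤n)))

firstDiff : ℕ → ℕ → List Elt → Elt
firstDiff u v (x ∷ y ∷ _) = subG u v x y
firstDiff u v _           = (0 , 0)

firstDiff∈Δ : ∀ u v B → Unique B → 2 ≤ length B → firstDiff u v B ∈ Δ u v B
firstDiff∈Δ u v (x ∷ []) _ (s≤s ())
firstDiff∈Δ u v (x ∷ y ∷ B) ((x≢y ∷ _) ∷ _) _ = 1≤occ⇒∈ (Δ u v (x ∷ y ∷ B)) (begin
  1                                                          ≡⟨ sym (𝟙-yes refl (d ≟E d)) ⟩
  𝟙 (d ≟E d)                                                 ≡⟨ sym (diffOcc-≢ u v d x≢y) ⟩
  diffOcc u v d x y                                          ≤⟨ term≤∑ (diffOcc u v d x) (x ∷ y ∷ B) (there (here refl)) ⟩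
  ∑ (diffOcc u v d x) (x ∷ y ∷ B)                            ≤⟨ term≤∑ (λ z → ∑ (diffOcc u v d z) (x ∷ y ∷ B)) (x ∷ y ∷ B) (here refl) ⟩
  ∑ (λ z → ∑ (diffOcc u v d z) (x ∷ y ∷ B)) (x ∷ y ∷ B)      ≡⟨ sym (occ-Δ u v d (x ∷ y ∷ B)) ⟩
  occ d (Δ u v (x ∷ y ∷ B))                                  ∎)
  where
  open ≤-Reasoning
  d = subG u v x y

Unique-map-firstDiff : ∀ u v 𝓑 → All Unique 𝓑 → All (λ B → 2 ≤ length B) 𝓑 →
                       Unique (allDiffs u v 𝓑) → Unique (map (firstDiff u v) 𝓑)
Unique-map-firstDiff u v 𝓑 sets bigs uniq = occ≤1⇒Unique _ λ e → begin
  occ e (map (firstDiff u v) 𝓑)                  ≡⟨ ∑-map _ (firstDiff u v) 𝓑 ⟩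
  ∑ (λ B → 𝟙 (e ≟E firstDiff u v B)) 𝓑           ≤⟨ ∑-mono-≤ 𝓑 (λ B∈ → 𝟙≤occ e B∈) ⟩
  ∑ (λ B → occ e (Δ u v B)) 𝓑                   ≡⟨ sym (occ-allDiffs u v e 𝓑) ⟩
  occ e (allDiffs u v 𝓑)                         ≤⟨ Unique⇒occ≤1 e _ uniq ⟩
  1                                              ∎
  where
  open ≤-Reasoning
  𝟙≤occ : ∀ e {B} → B ∈ 𝓑 → 𝟙 (e ≟E firstDiff u v B) ≤ occ e (Δ u v B)
  𝟙≤occ e {B} B∈ with e ≟E firstDiff u v B
  ... | yes refl = ∈⇒1≤occ _ (firstDiff∈Δ u v B (lookup sets B∈) (lookup bigs B∈))
  ... | no  _    = z≤n

Unique-map-filter : ∀ {P : Pred A p} (P? : Decidable P) (f : A → Elt) xs →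
                    Unique (map f xs) → Unique (map f (filter P? xs))
Unique-map-filter P? f xs uniq = occ≤1⇒Unique _ λ e → begin
  occ e (map f (filter P? xs))          ≡⟨ ∑-map _ f (filter P? xs) ⟩
  ∑ (λ x → 𝟙 (e ≟E f x)) (filter P? xs) ≤⟨ ∑-filter-≤ P? _ xs ⟩
  ∑ (λ x → 𝟙 (e ≟E f x)) xs             ≡⟨ sym (∑-map _ f xs) ⟩
  occ e (map f xs)                      ≤⟨ Unique⇒occ≤1 e _ uniq ⟩
  1                                     ∎
  where open ≤-Reasoning

-- Blocks of size at most 1 contribute no differences, so the constructions work with
-- blocks of size ≥ 2 only; `ProperBDP→BDP` restores distinctness and balance.
record ProperBDP (u v s t : ℕ) (K : List ℕ) : Set where
  field
    u-pos      : 1 ≤ u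
    v-pos      : 1 ≤ v
    s∣u        : s ∣ u
    t∣v        : t ∣ v
    blocks     : List (List Elt)
    block-elts : All (All (InG u v)) blocks
    block-set  : All Unique blocks
    block-size : All (λ B → length B ∈ K) blocks
    block-big  : All (λ B → 2 ≤ length B) blocks
    balanced   : ∀ {k k′} → k ∈ K → k′ ∈ K → 2 ≤ k → 2 ≤ k′ → numBlocks k blocks ≡ numBlocks k′ blocks
    leave      : HasLeave u v s t (allDiffs u v blocks)

BDP→ProperBDP : ∀ {u v s t K} → BDP u v s t K → ProperBDP u v s t K
BDP→ProperBDP {u} {v} {s} {t} {K} P = record
  { u-pos      = u-pos
  ; v-pos      = v-pos
  ; s∣u        = s∣u
  ; t∣v        = t∣v
  ; blocks     = filter big? blocks
  ; block-elts = Allₚ.filter⁺ big? block-elts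
  ; block-set  = Allₚ.filter⁺ big? block-set
  ; block-size = Allₚ.filter⁺ big? block-size
  ; block-big  = Allₚ.all-filter big? blocks
  ; balanced   = λ k∈ k′∈ 2≤k 2≤k′ →
      trans (numBlocks-big 2≤k) (trans (balanced k∈ k′∈) (sym (numBlocks-big 2≤k′)))
  ; leave      = λ e e∈G → trans (occ-big e) (packing-leave⇒HasLeave {s = s} {t} packing leave e e∈G)
  }
  where
  open BDP P
  big? : (B : List Elt) → Dec (2 ≤ length B)
  big? B = 2 ≤? length B
  numBlocks-big : ∀ {k} → 2 ≤ k → numBlocks k (filter big? blocks) ≡ numBlocks k blocks
  numBlocks-big {k} 2≤k = begin
    numBlocks k (filter big? blocks)                  ≡⟨ numBlocks≡∑ k (filter big? blocks) ⟩
    ∑ (λ B → 𝟙 (length B ≟ k)) (filter big? blocks)   ≡⟨ ∑-filter big? _ (λ B ¬2≤ → 𝟙-no (λ { refl → ¬2≤ 2≤k }) _) blocks ⟩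
    ∑ (λ B → 𝟙 (length B ≟ k)) blocks                 ≡⟨ numBlocks≡∑ k blocks ⟨
    numBlocks k blocks                                ∎
    where open ≡-Reasoning
  occ-big : ∀ e → occ e (allDiffs u v (filter big? blocks)) ≡ occ e (allDiffs u v blocks)
  occ-big e = begin
    occ e (allDiffs u v (filter big? blocks))         ≡⟨ occ-allDiffs u v e (filter big? blocks) ⟩
    ∑ (λ B → occ e (Δ u v B)) (filter big? blocks)    ≡⟨ ∑-filter big? _ (λ B → occ-Δ-small u v e B) blocks ⟩
    ∑ (λ B → occ e (Δ u v B)) blocks                  ≡⟨ occ-allDiffs u v e blocks ⟨
    occ e (allDiffs u v blocks)                       ∎
    where open ≡-Reasoning

firstDiff-InG : ∀ {u v} → 1 ≤ u → 1 ≤ v → ∀ B → InG u v (firstDiff u v B)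
firstDiff-InG 1≤u 1≤v (x ∷ y ∷ _) = subG-InG x y 1≤u 1≤v
firstDiff-InG 1≤u 1≤v []          = 1≤u , 1≤v
firstDiff-InG 1≤u 1≤v (_ ∷ [])    = 1≤u , 1≤v

numBlocks-++ : ∀ k 𝓑 𝓒 → numBlocks k (𝓑 ++ 𝓒) ≡ numBlocks k 𝓑 + numBlocks k 𝓒
numBlocks-++ k 𝓑 𝓒 = trans (cong length (filter-++ (λ B → length B ≟ k) 𝓑 𝓒)) (length-++ (filter _ 𝓑))

module FromProper {u v s t K} (P : ProperBDP u v s t K) where
  open ProperBDP P

  Unique-blocks : Unique blocks
  Unique-blocks = Uniqueₚ.map⁻ (Unique-map-firstDiff u v blocks block-set block-big
                    (HasLeave⇒Unique s t blocks u-pos v-pos leave))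

  withSingletons : (𝓒 : List (List Elt)) → Unique (blocks ++ 𝓒) → All (All (InG u v)) 𝓒 → All Unique 𝓒 →
                   All (λ B → length B ∈ K) 𝓒 → All (λ B → length B ≡ 1) 𝓒 →
                   (∀ {k k′} → k ∈ K → k′ ∈ K → numBlocks k (blocks ++ 𝓒) ≡ numBlocks k′ (blocks ++ 𝓒)) →
                   BDP u v s t K
  withSingletons 𝓒 distinct elts sets sizes singles bal = record
    { u-pos           = u-pos
    ; v-pos           = v-pos
    ; s∣u             = s∣u
    ; t∣v             = t∣v
    ; blocks          = blocks ++ 𝓒
    ; blocks-distinct = distinct
    ; block-elts      = Allₚ.++⁺ block-elts elts
    ; block-set       = Allₚ.++⁺ block-set sets
    ; block-size      = Allₚ.++⁺ block-size sizes
    ; packing         = HasLeave⇒Unique s t (blocks ++ 𝓒) u-pos v-pos leave′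
    ; balanced        = bal
    ; leave           = HasLeave⇒leave s t leave′
    }
    where
    no-diffs : ∀ e → occ e (allDiffs u v 𝓒) ≡ 0
    no-diffs e = trans (occ-allDiffs u v e 𝓒)
      (∑-zero 𝓒 λ {B} B∈ → occ-Δ-small u v e B λ 2≤ → <⇒≱ 2≤ (≤-reflexive (lookup singles B∈)))
    leave′ : HasLeave u v s t (allDiffs u v (blocks ++ 𝓒))
    leave′ e e∈G = begin
      occ e (allDiffs u v (blocks ++ 𝓒))                    ≡⟨ occ-allDiffs-++ u v e blocks 𝓒 ⟩
      occ e (allDiffs u v blocks) + occ e (allDiffs u v 𝓒)  ≡⟨ cong (occ e (allDiffs u v blocks) +_) (no-diffs e) ⟩
      occ e (allDiffs u v blocks) + 0                       ≡⟨ +-identityʳ _ ⟩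
      occ e (allDiffs u v blocks)                           ≡⟨ leave e e∈G ⟩
      𝟙 (¬? (InH? u v s t e))                               ∎
      where open ≡-Reasoning

  unpadded : (∀ {k k′} → k ∈ K → k′ ∈ K → numBlocks k blocks ≡ numBlocks k′ blocks) → BDP u v s t K
  unpadded bal = withSingletons [] (subst Unique (sym (++-identityʳ blocks)) Unique-blocks) [] [] [] []
    (λ k∈ k′∈ → subst (λ 𝓑 → numBlocks _ 𝓑 ≡ numBlocks _ 𝓑) (sym (++-identityʳ blocks)) (bal k∈ k′∈))

  -- Singletons have no differences; taking them to be the first differences of the blocks
  -- of size k₀ makes them distinct and as many as those blocks.
  padded : All (1 ≤_) K → ∀ {k₀} → k₀ ∈ K → 2 ≤ k₀ → 1 ∈ K → BDP u v s t K
  padded 1≤K {k₀} k₀∈ 2≤k₀ 1∈K = withSingletons S distinct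
    (Allₚ.map⁺ (Allₚ.map⁺ (tabulate λ {B} _ → firstDiff-InG u-pos v-pos B ∷ [])))
    (Allₚ.map⁺ (tabulate λ _ → [] ∷ []))
    (Allₚ.map⁺ (tabulate λ _ → 1∈K))
    (Allₚ.map⁺ (tabulate λ _ → refl))
    (λ k∈ k′∈ → trans (count k∈) (sym (count k′∈)))
    where
    F S : List (List Elt)
    F = filter (λ B → length B ≟ k₀) blocks
    S = map [_] (map (firstDiff u v) F)
    all-big : ∀ {k} → k < 2 → All (λ B → length B ≢ k) blocks
    all-big k<2 = All.map (λ 2≤ eq → <⇒≱ k<2 (subst (2 ≤_) eq 2≤)) block-big
    length≡1 : ∀ {B} → B ∈ S → length B ≡ 1
    length≡1 B∈ with ∈-map⁻ [_] B∈
    ... | _ , _ , refl = refl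
    distinct : Unique (blocks ++ S)
    distinct = Uniqueₚ.++⁺ Unique-blocks
      (Uniqueₚ.map⁺ (λ { refl → refl }) (Unique-map-filter _ (firstDiff u v) blocks
        (Unique-map-firstDiff u v blocks block-set block-big (HasLeave⇒Unique s t blocks u-pos v-pos leave))))
      (λ (B∈ , B∈S) → lookup (all-big ≤-refl) B∈ (length≡1 B∈S))
    count : ∀ {k} → k ∈ K → numBlocks k (blocks ++ S) ≡ numBlocks k₀ blocks
    count {k} k∈ with k ≟ 1
    ... | yes refl = begin
      numBlocks 1 (blocks ++ S)        ≡⟨ numBlocks-++ 1 blocks S ⟩
      numBlocks 1 blocks + numBlocks 1 S ≡⟨ cong₂ _+_ (cong length (filter-none _ (all-big ≤-refl))) (cong length (filter-all _ (tabulate length≡1))) ⟩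
      length S                          ≡⟨ length-map [_] (map (firstDiff u v) F) ⟩
      length (map (firstDiff u v) F)     ≡⟨ length-map (firstDiff u v) F ⟩
      numBlocks k₀ blocks              ∎
      where open ≡-Reasoning
    ... | no k≢1 = begin
      numBlocks k (blocks ++ S)        ≡⟨ numBlocks-++ k blocks S ⟩
      numBlocks k blocks + numBlocks k S ≡⟨ cong (numBlocks k blocks +_) (cong length (filter-none _ (tabulate λ B∈S eq → k≢1 (trans (sym eq) (length≡1 B∈S))))) ⟩
      numBlocks k blocks + 0           ≡⟨ +-identityʳ _ ⟩
      numBlocks k blocks               ≡⟨ balanced k∈ k₀∈ (≤∧≢⇒< (lookup 1≤K k∈) (k≢1 ∘′ sym)) 2≤k₀ ⟩
      numBlocks k₀ blocks              ∎
      where open ≡-Reasoning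

ProperBDP→BDP : ∀ {u v s t K} → All (1 ≤_) K → ProperBDP u v s t K → BDP u v s t K
ProperBDP→BDP {K = K} 1≤K P with 1 ∈ℕ? K | any? (2 ≤?_) K
... | no 1∉K | _ = unpadded λ k∈ k′∈ → balanced k∈ k′∈ (2≤ k∈) (2≤ k′∈)
  where
  open ProperBDP P
  open FromProper P
  2≤ : ∀ {k} → k ∈ K → 2 ≤ k
  2≤ k∈ = ≤∧≢⇒< (lookup 1≤K k∈) λ { refl → 1∉K k∈ }
... | yes _ | no ∄2≤ = unpadded λ k∈ k′∈ → cong (λ k → numBlocks k blocks) (trans (≡1 k∈) (sym (≡1 k′∈)))
  where
  open ProperBDP P
  open FromProper P
  ≡1 : ∀ {k} → k ∈ K → k ≡ 1
  ≡1 k∈ = ≤-antisym (≮⇒≥ λ 2≤k → ∄2≤ (Any.map (λ { refl → 2≤k }) k∈)) (lookup 1≤K k∈)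
... | yes 1∈K | yes ∃2≤ = let (k₀ , k₀∈ , 2≤k₀) = find ∃2≤ in FromProper.padded P 1≤K k₀∈ 2≤k₀ 1∈K

numBlocks-map-map : ∀ k (f : Elt → Elt) 𝓑 → numBlocks k (map (map f) 𝓑) ≡ numBlocks k 𝓑
numBlocks-map-map k f 𝓑 = begin
  numBlocks k (map (map f) 𝓑)                     ≡⟨ numBlocks≡∑ k (map (map f) 𝓑) ⟩
  ∑ (λ B → 𝟙 (length B ≟ k)) (map (map f) 𝓑)      ≡⟨ ∑-map _ (map f) 𝓑 ⟩
  ∑ (λ B → 𝟙 (length (map f B) ≟ k)) 𝓑            ≡⟨ ∑-cong 𝓑 (λ {B} _ → cong (λ n → 𝟙 (n ≟ k)) (length-map f B)) ⟩
  ∑ (λ B → 𝟙 (length B ≟ k)) 𝓑                    ≡⟨ numBlocks≡∑ k 𝓑 ⟨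
  numBlocks k 𝓑                                   ∎
  where open ≡-Reasoning

All-length-map-map : ∀ (R : ℕ → Set) (f : Elt → Elt) {𝓑} → All (λ B → R (length B)) 𝓑 →
                     All (λ B → R (length B)) (map (map f) 𝓑)
All-length-map-map R f = Allₚ.map⁺ ∘′ All.map (λ {B} → subst R (sym (length-map f B)))

All-Unique-map-map : ∀ {f : Elt → Elt} → (∀ {x y} → f x ≡ f y → x ≡ y) → ∀ {𝓑} →
                     All Unique 𝓑 → All Unique (map (map f) 𝓑)
All-Unique-map-map f-inj = Allₚ.map⁺ ∘′ All.map (Uniqueₚ.map⁺ f-inj)

All-All-map-map : ∀ {P Q : Elt → Set} {f : Elt → Elt} → (∀ {x} → P x → Q (f x)) → ∀ {𝓑} →
                  All (All P) 𝓑 → All (All Q) (map (map f) 𝓑)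
All-All-map-map P⇒Q = Allₚ.map⁺ ∘′ All.map (Allₚ.map⁺ ∘′ All.map P⇒Q)

module Relabel {u v U V : ℕ} (f : Elt → Elt) (f-inj : ∀ {x y} → f x ≡ f y → x ≡ y)
               (f-sub : ∀ x y → f (subG u v x y) ≡ subG U V (f x) (f y)) where

  diffOcc-relabel : ∀ e x y → diffOcc U V (f e) (f x) (f y) ≡ diffOcc u v e x y
  diffOcc-relabel e x y with x ≟E y
  ... | yes x≡y = diffOcc-≡ U V (f e) (cong f x≡y)
  ... | no  x≢y = trans (diffOcc-≢ U V (f e) (x≢y ∘′ f-inj))
                    (𝟙-cong (λ eq → f-inj (trans eq (sym (f-sub x y)))) (λ eq → trans (cong f eq) (f-sub x y)) _ _)

  occ-Δ-relabel : ∀ e B → occ (f e) (Δ U V (map f B)) ≡ occ e (Δ u v B)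
  occ-Δ-relabel e B = trans (occ-Δ-map U V (f e) f B)
    (trans (∑-cong B λ {x} _ → ∑-cong B λ {y} _ → diffOcc-relabel e x y) (sym (occ-Δ u v e B)))

  occ-allDiffs-relabel : ∀ e 𝓑 → occ (f e) (allDiffs U V (map (map f) 𝓑)) ≡ occ e (allDiffs u v 𝓑)
  occ-allDiffs-relabel e 𝓑 = begin
    occ (f e) (allDiffs U V (map (map f) 𝓑))     ≡⟨ occ-allDiffs U V (f e) (map (map f) 𝓑) ⟩
    ∑ (λ B → occ (f e) (Δ U V B)) (map (map f) 𝓑) ≡⟨ ∑-map _ (map f) 𝓑 ⟩
    ∑ (λ B → occ (f e) (Δ U V (map f B))) 𝓑       ≡⟨ ∑-cong 𝓑 (λ {B} _ → occ-Δ-relabel e B) ⟩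
    ∑ (λ B → occ e (Δ u v B)) 𝓑                   ≡⟨ occ-allDiffs u v e 𝓑 ⟨
    occ e (allDiffs u v 𝓑)                        ∎
    where open ≡-Reasoning

  occ-allDiffs-relabel-∉ : ∀ e 𝓑 → (∀ x y → e ≢ f (subG u v x y)) → occ e (allDiffs U V (map (map f) 𝓑)) ≡ 0
  occ-allDiffs-relabel-∉ e 𝓑 e∉im = trans (occ-allDiffs U V e (map (map f) 𝓑))
    (trans (∑-map (λ B → occ e (Δ U V B)) (map f) 𝓑) (∑-zero 𝓑 λ {B} _ →
      trans (occ-Δ-map U V e f B) (∑-zero B λ {x} _ → ∑-zero B λ {y} _ → diffOcc-∉ x y)))
    where
    diffOcc-∉ : ∀ x y → diffOcc U V e (f x) (f y) ≡ 0
    diffOcc-∉ x y with f x ≟E f y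
    ... | yes _ = refl
    ... | no  _ = 𝟙-no (λ eq → e∉im x y (trans eq (sym (f-sub x y)))) _

swap : Elt → Elt
swap (x , y) = (y , x)

swap-injective : ∀ {a b} → swap a ≡ swap b → a ≡ b
swap-injective = cong swap

swapProperBDP : ∀ {u v s t K} → ProperBDP u v s t K → ProperBDP v u t s K
swapProperBDP {u} {v} {s} {t} {K} P = record
  { u-pos      = v-pos
  ; v-pos      = u-pos
  ; s∣u        = t∣v
  ; t∣v        = s∣u
  ; blocks     = map (map swap) blocks
  ; block-elts = All-All-map-map (λ (x<u , y<v) → y<v , x<u) block-elts
  ; block-set  = All-Unique-map-map swap-injective block-set
  ; block-size = All-length-map-map (_∈ K) swap block-size
  ; block-big  = All-length-map-map (2 ≤_) swap block-big
  ; balanced   = λ {k} {k′} k∈ k′∈ 2≤k 2≤k′ → trans (numBlocks-map-map k swap blocks)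
                   (trans (balanced k∈ k′∈ 2≤k 2≤k′) (sym (numBlocks-map-map k′ swap blocks)))
  ; leave      = λ (y , x) (y<v , x<u) → trans (occ-allDiffs-relabel (x , y) blocks)
                   (trans (leave (x , y) (x<u , y<v)) (𝟙-cong (_∘′ ×-swap) (_∘′ ×-swap) _ _))
  }
  where
  open ProperBDP P
  open Relabel {u} {v} {v} {u} swap swap-injective (λ _ _ → refl)

subZ-scale : ∀ c G a b → .{{NonZero c}} → .{{NonZero G}} → subZ (c * G) (c * a) (c * b) ≡ c * subZ G a b
subZ-scale c@(suc _) G@(suc _) a b = begin
  (c * a + (c * G ∸ c * b)) % (c * G)  ≡⟨ cong (λ z → (c * a + z) % (c * G)) (*-distribˡ-∸ c G b) ⟨
  (c * a + c * (G ∸ b)) % (c * G)      ≡⟨ cong (_% (c * G)) (*-distribˡ-+ c a (G ∸ b)) ⟨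
  (c * X) % (c * G)                    ≡⟨ cong (_% (c * G)) (*-comm c X) ⟩
  (X * c) % (c * G)                    ≡⟨ %-congʳ {o = X * c} (*-comm c G) ⟩
  (X * c) % (G * c)                    ≡⟨ m%n*o≡m*o%[n*o] X G c ⟨
  X % G * c                            ≡⟨ *-comm (X % G) c ⟩
  c * (X % G)                          ∎
  where
  open ≡-Reasoning
  X : ℕ
  X = a + (G ∸ b)

divN-* : ∀ q d → 1 ≤ d → divN (q * d) d ≡ q
divN-* q (suc d) _ = m*n/n≡m q (suc d)

1≤*⇒1≤ˡ : ∀ m n → 1 ≤ m * n → 1 ≤ m
1≤*⇒1≤ˡ (suc m) n _ = s≤s z≤n

1≤*⇒1≤ʳ : ∀ m n → 1 ≤ m * n → 1 ≤ n
1≤*⇒1≤ʳ m n 1≤mn = 1≤*⇒1≤ˡ n m (subst (1 ≤_) (*-comm m n) 1≤mn)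

divN-scale : ∀ c {G S} → 1 ≤ G → S ∣ G → divN (c * G) S ≡ c * divN G S
divN-scale c {S = S} 1≤G (divides σ refl) = begin
  divN (c * (σ * S)) S   ≡⟨ cong (λ n → divN n S) (*-assoc c σ S) ⟨
  divN (c * σ * S) S     ≡⟨ divN-* (c * σ) S 1≤S ⟩
  c * σ                  ≡⟨ cong (c *_) (divN-* σ S 1≤S) ⟨
  c * divN (σ * S) S     ∎
  where
  open ≡-Reasoning
  1≤S : 1 ≤ S
  1≤S = 1≤*⇒1≤ʳ σ S 1≤G

module _ (c : ℕ) .{{_ : NonZero c}} {G S : ℕ} (1≤G : 1 ≤ G) (S∣G : S ∣ G) where

  divN-scale-∣⇔ : ∀ x → (divN (c * G) S ∣ c * x) ⇔ (divN G S ∣ x)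
  divN-scale-∣⇔ x = mk⇔ (λ ∣cx → *-cancelˡ-∣ c (subst (_∣ c * x) (divN-scale c 1≤G S∣G) ∣cx))
                        (λ ∣x → subst (_∣ c * x) (sym (divN-scale c 1≤G S∣G)) (*-monoʳ-∣ c ∣x))

  divN-coarsen-∣ : ∀ x → divN (c * G) S ∣ x → c ∣ x
  divN-coarsen-∣ x ∣x = ∣-trans (m∣m*n (divN G S)) (subst (_∣ x) (divN-scale c 1≤G S∣G) ∣x)

module Fill {G H S T c d : ℕ} {K : List ℕ} .{{_ : NonZero c}} .{{_ : NonZero d}}
            (P₁ : ProperBDP (c * G) (d * H) G H K) (P₂ : ProperBDP G H S T K) where
  private
    module P₁ = ProperBDP P₁
    module P₂ = ProperBDP P₂
    instance
      G≢0 : NonZero G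
      G≢0 = >-nonZero P₂.u-pos
      H≢0 : NonZero H
      H≢0 = >-nonZero P₂.v-pos

  embed : Elt → Elt
  embed (x , y) = (c * x , d * y)

  embed-injective : ∀ {a b} → embed a ≡ embed b → a ≡ b
  embed-injective {x₁ , y₁} {x₂ , y₂} eq =
    cong₂ _,_ (*-cancelˡ-≡ x₁ x₂ c (cong proj₁ eq)) (*-cancelˡ-≡ y₁ y₂ d (cong proj₂ eq))

  embed-subG : ∀ a b → embed (subG G H a b) ≡ subG (c * G) (d * H) (embed a) (embed b)
  embed-subG (x₁ , y₁) (x₂ , y₂) = sym (cong₂ _,_ (subZ-scale c G x₁ x₂) (subZ-scale d H y₁ y₂))

  embed-InG : ∀ {a} → InG G H a → InG (c * G) (d * H) (embed a)
  embed-InG (x<G , y<H) = *-monoʳ-< c x<G , *-monoʳ-< d y<H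

  embed-InH : ∀ a → InH (c * G) (d * H) S T (embed a) ⇔ InH G H S T a
  embed-InH (x , y) = divN-scale-∣⇔ c P₂.u-pos P₂.s∣u x ×-⇔ divN-scale-∣⇔ d P₂.v-pos P₂.t∣v y

  embed-InH-GH : ∀ a → InH (c * G) (d * H) G H (embed a)
  embed-InH-GH (x , y) = subst (_∣ c * x) (sym (divN-* c G P₂.u-pos)) (m∣m*n x) ,
                         subst (_∣ d * y) (sym (divN-* d H P₂.v-pos)) (m∣m*n y)

  InH-coarsen : ∀ {e} → InH (c * G) (d * H) S T e → InH (c * G) (d * H) G H e
  InH-coarsen {x , y} (∣x , ∣y) =
    subst (_∣ x) (sym (divN-* c G P₂.u-pos)) (divN-coarsen-∣ c P₂.u-pos P₂.s∣u x ∣x) ,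
    subst (_∣ y) (sym (divN-* d H P₂.v-pos)) (divN-coarsen-∣ d P₂.v-pos P₂.t∣v y ∣y)

  embed-surjective : ∀ {e} → InG (c * G) (d * H) e → InH (c * G) (d * H) G H e →
                     Σ Elt λ a → InG G H a × embed a ≡ e
  embed-surjective {x , y} (x< , y<) (∣x , ∣y)
    with subst (_∣ x) (divN-* c G P₂.u-pos) ∣x | subst (_∣ y) (divN-* d H P₂.v-pos) ∣y
  ... | divides qx refl | divides qy refl =
    (qx , qy) , (*-cancelˡ-< c qx G (subst (_< c * G) (*-comm qx c) x<) ,
                 *-cancelˡ-< d qy H (subst (_< d * H) (*-comm qy d) y<)) ,
    cong₂ _,_ (*-comm c qx) (*-comm d qy)

  open Relabel {G} {H} {c * G} {d * H} embed embed-injective embed-subG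

  blocks : List (List Elt)
  blocks = P₁.blocks ++ map (map embed) P₂.blocks

  leave-H : ∀ a → InG G H a → occ (embed a) (allDiffs (c * G) (d * H) blocks) ≡ 𝟙 (¬? (InH? (c * G) (d * H) S T (embed a)))
  leave-H a a∈G = begin
    occ (embed a) (allDiffs (c * G) (d * H) blocks)   ≡⟨ occ-allDiffs-++ _ _ (embed a) P₁.blocks _ ⟩
    occ (embed a) (allDiffs (c * G) (d * H) P₁.blocks) + occ (embed a) (allDiffs (c * G) (d * H) (map (map embed) P₂.blocks))
      ≡⟨ cong₂ _+_ (trans (P₁.leave (embed a) (embed-InG a∈G)) (𝟙-no (λ ∉H → ∉H (embed-InH-GH a)) _)) (occ-allDiffs-relabel a P₂.blocks) ⟩
    occ a (allDiffs G H P₂.blocks)                    ≡⟨ P₂.leave a a∈G ⟩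
    𝟙 (¬? (InH? G H S T a))                            ≡⟨ 𝟙-cong (_∘′ Equivalence.to (embed-InH a)) (_∘′ Equivalence.from (embed-InH a)) _ _ ⟩
    𝟙 (¬? (InH? (c * G) (d * H) S T (embed a)))        ∎
    where open ≡-Reasoning

  leave-off-H : ∀ e → InG (c * G) (d * H) e → ¬ InH (c * G) (d * H) G H e →
                occ e (allDiffs (c * G) (d * H) blocks) ≡ 𝟙 (¬? (InH? (c * G) (d * H) S T e))
  leave-off-H e e∈G e∉H = begin
    occ e (allDiffs (c * G) (d * H) blocks)   ≡⟨ occ-allDiffs-++ _ _ e P₁.blocks _ ⟩
    occ e (allDiffs (c * G) (d * H) P₁.blocks) + occ e (allDiffs (c * G) (d * H) (map (map embed) P₂.blocks))
      ≡⟨ cong₂ _+_ (trans (P₁.leave e e∈G) (𝟙-yes e∉H _))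
                   (occ-allDiffs-relabel-∉ e P₂.blocks λ x y → λ { refl → e∉H (embed-InH-GH (subG G H x y)) }) ⟩
    1                                          ≡⟨ 𝟙-yes (e∉H ∘′ InH-coarsen) _ ⟨
    𝟙 (¬? (InH? (c * G) (d * H) S T e))        ∎
    where open ≡-Reasoning

  filled : ProperBDP (c * G) (d * H) S T K
  filled = record
    { u-pos      = P₁.u-pos
    ; v-pos      = P₁.v-pos
    ; s∣u        = ∣-trans P₂.s∣u P₁.s∣u
    ; t∣v        = ∣-trans P₂.t∣v P₁.t∣v
    ; blocks     = blocks
    ; block-elts = Allₚ.++⁺ P₁.block-elts (All-All-map-map embed-InG P₂.block-elts)
    ; block-set  = Allₚ.++⁺ P₁.block-set (All-Unique-map-map embed-injective P₂.block-set)
    ; block-size = Allₚ.++⁺ P₁.block-size (All-length-map-map (_∈ K) embed P₂.block-size)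
    ; block-big  = Allₚ.++⁺ P₁.block-big (All-length-map-map (2 ≤_) embed P₂.block-big)
    ; balanced   = λ {k} {k′} k∈ k′∈ 2≤k 2≤k′ → begin
        numBlocks k blocks                                       ≡⟨ count k ⟩
        numBlocks k P₁.blocks + numBlocks k P₂.blocks            ≡⟨ cong₂ _+_ (P₁.balanced k∈ k′∈ 2≤k 2≤k′) (P₂.balanced k∈ k′∈ 2≤k 2≤k′) ⟩
        numBlocks k′ P₁.blocks + numBlocks k′ P₂.blocks          ≡⟨ count k′ ⟨
        numBlocks k′ blocks                                      ∎
    ; leave      = leave
    }
    where
    open ≡-Reasoning
    count : ∀ k → numBlocks k blocks ≡ numBlocks k P₁.blocks + numBlocks k P₂.blocks
    count k = trans (numBlocks-++ k P₁.blocks _) (cong (numBlocks k P₁.blocks +_) (numBlocks-map-map k embed P₂.blocks))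
    leave : HasLeave (c * G) (d * H) S T (allDiffs (c * G) (d * H) blocks)
    leave e e∈G with InH? (c * G) (d * H) G H e
    ... | no e∉H = leave-off-H e e∈G e∉H
    ... | yes e∈H with embed-surjective e∈G e∈H
    ... | a , a∈G , refl = leave-H a a∈G

fill : ∀ {U V G H S T K} → ProperBDP U V G H K → ProperBDP G H S T K → ProperBDP U V S T K
fill P₁ P₂ with ProperBDP.s∣u P₁ | ProperBDP.t∣v P₁ | ProperBDP.u-pos P₁ | ProperBDP.v-pos P₁
... | divides c refl | divides d refl | 1≤U | 1≤V = Fill.filled {{c≢0}} {{d≢0}} P₁ P₂
  where
  c≢0 : NonZero c
  c≢0 = >-nonZero (1≤*⇒1≤ˡ c _ 1≤U)
  d≢0 : NonZero d
  d≢0 = >-nonZero (1≤*⇒1≤ˡ d _ 1≤V)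

%-absorbʳ : ∀ a k n .{{_ : NonZero n}} → (a + k % n) % n ≡ (a + k) % n
%-absorbʳ a k n = begin
  (a + k % n) % n           ≡⟨ %-distribˡ-+ a (k % n) n ⟩
  (a % n + k % n % n) % n   ≡⟨ cong (λ x → (a % n + x) % n) (m%n%n≡m%n k n) ⟩
  (a % n + k % n) % n       ≡⟨ %-distribˡ-+ a k n ⟨
  (a + k) % n               ∎
  where open ≡-Reasoning

%-absorbˡ : ∀ k a n .{{_ : NonZero n}} → (k % n + a) % n ≡ (k + a) % n
%-absorbˡ k a n = trans (cong (_% n) (+-comm (k % n) a)) (trans (%-absorbʳ a k n) (cong (_% n) (+-comm a k)))

+-∸-rotate : ∀ {b n} x → b ≤ n → b + x + (n ∸ b) ≡ x + n
+-∸-rotate {b} {n} x b≤n = trans (cong (_+ (n ∸ b)) (+-comm b x)) (trans (+-assoc x b _) (cong (x +_) (m+[n∸m]≡n b≤n)))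

subZ≡% : ∀ n a b .{{_ : NonZero n}} → subZ n a b ≡ (a + (n ∸ b)) % n
subZ≡% (suc n) a b = refl

subZ-spec : ∀ n {a b z} .{{_ : NonZero n}} → a < n → b < n → z < n → (z ≡ subZ n a b) ⇔ ((b + z) % n ≡ a)
subZ-spec n {a} {b} {z} a<n b<n z<n = mk⇔ to from
  where
  open ≡-Reasoning
  to : z ≡ subZ n a b → (b + z) % n ≡ a
  to refl = begin
    (b + subZ n a b) % n            ≡⟨ cong (λ x → (b + x) % n) (subZ≡% n a b) ⟩
    (b + (a + (n ∸ b)) % n) % n     ≡⟨ %-absorbʳ b _ n ⟩
    (b + (a + (n ∸ b))) % n         ≡⟨ cong (_% n) (+-assoc b a (n ∸ b)) ⟨
    (b + a + (n ∸ b)) % n           ≡⟨ cong (_% n) (+-∸-rotate a (<⇒≤ b<n)) ⟩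
    (a + n) % n                     ≡⟨ [m+n]%n≡m%n a n ⟩
    a % n                           ≡⟨ m<n⇒m%n≡m a<n ⟩
    a                               ∎
  from : (b + z) % n ≡ a → z ≡ subZ n a b
  from refl = sym (begin
    subZ n ((b + z) % n) b          ≡⟨ subZ≡% n _ b ⟩
    ((b + z) % n + (n ∸ b)) % n     ≡⟨ %-absorbˡ (b + z) _ n ⟩
    (b + z + (n ∸ b)) % n           ≡⟨ cong (_% n) (+-∸-rotate z (<⇒≤ b<n)) ⟩
    (z + n) % n                     ≡⟨ [m+n]%n≡m%n z n ⟩
    z % n                           ≡⟨ m<n⇒m%n≡m z<n ⟩
    z                               ∎)

digits-< : ∀ m v {a X} → a < v → X < m → a + v * X < m * v
digits-< m v {a} {X} a<v X<m = begin-strict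
  a + v * X   <⟨ +-monoˡ-< (v * X) a<v ⟩
  v + v * X   ≡⟨ *-suc v X ⟨
  v * suc X   ≤⟨ *-monoʳ-≤ v X<m ⟩
  v * m       ≡⟨ *-comm v m ⟩
  m * v       ∎
  where open ≤-Reasoning

digits-≡⇔ : ∀ v .{{_ : NonZero v}} {a a′ X X′} → a < v → a′ < v →
            (a + v * X ≡ a′ + v * X′) ⇔ (a ≡ a′ × X ≡ X′)
digits-≡⇔ v {a} {a′} {X} {X′} a<v a′<v = mk⇔ to λ { (refl , refl) → refl }
  where
  low : ∀ {b} Y → b < v → (b + v * Y) % v ≡ b
  low {b} Y b<v = trans (cong (λ w → (b + w) % v) (*-comm v Y)) (trans ([m+kn]%n≡m%n b Y v) (m<n⇒m%n≡m b<v))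
  to : a + v * X ≡ a′ + v * X′ → a ≡ a′ × X ≡ X′
  to eq = a≡a′ , *-cancelˡ-≡ X X′ v (+-cancelˡ-≡ a _ _ (trans eq (cong (_+ v * X′) (sym a≡a′))))
    where
    a≡a′ : a ≡ a′
    a≡a′ = trans (sym (low X a<v)) (trans (cong (_% v) eq) (low X′ a′<v))

digits-% : ∀ m v .{{_ : NonZero m}} .{{_ : NonZero v}} .{{_ : NonZero (m * v)}} a X →
           (a + v * X) % (m * v) ≡ a % v + v * ((a / v + X) % m)
digits-% m v a X = begin
  (a + v * X) % (m * v)                              ≡⟨ cong (_% (m * v)) split ⟩
  (a % v + v * (Y % m) + (Y / m) * (m * v)) % (m * v) ≡⟨ [m+kn]%n≡m%n _ (Y / m) (m * v) ⟩
  (a % v + v * (Y % m)) % (m * v)                    ≡⟨ m<n⇒m%n≡m (digits-< m v (m%n<n a v) (m%n<n Y m)) ⟩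
  a % v + v * (Y % m)                                ∎
  where
  open ≡-Reasoning
  Y : ℕ
  Y = a / v + X
  split : a + v * X ≡ a % v + v * (Y % m) + (Y / m) * (m * v)
  split = begin
    a + v * X                                 ≡⟨ cong (_+ v * X) (m≡m%n+[m/n]*n a v) ⟩
    a % v + a / v * v + v * X                 ≡⟨ solve 4 (λ r q v X → r :+ q :* v :+ v :* X := r :+ v :* (q :+ X)) refl (a % v) (a / v) v X ⟩
    a % v + v * Y                             ≡⟨ cong (λ y → a % v + v * y) (m≡m%n+[m/n]*n Y m) ⟩
    a % v + v * (Y % m + Y / m * m)           ≡⟨ solve 5 (λ r v s q m → r :+ v :* (s :+ q :* m) := r :+ v :* s :+ q :* (m :* v)) refl (a % v) v (Y % m) (Y / m) m ⟩
    a % v + v * (Y % m) + (Y / m) * (m * v)   ∎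

≡-sym-⇔ : ∀ {a b : ℕ} → (a ≡ b) ⇔ (b ≡ a)
≡-sym-⇔ = mk⇔ sym sym

≡-trans-⇔ : ∀ {a b c : ℕ} → a ≡ b → (a ≡ c) ⇔ (b ≡ c)
≡-trans-⇔ a≡b = mk⇔ (trans (sym a≡b)) (trans a≡b)

-- The high digit, modulo m, of yq + z written in base v: the low digits may carry.
carry : ∀ m v .{{_ : NonZero m}} .{{_ : NonZero v}} → ℕ → ℕ → ℕ
carry m v yq z = ((yq + z % v) / v + z / v) % m

carry-< : ∀ m v .{{_ : NonZero m}} .{{_ : NonZero v}} yq z → carry m v yq z < m
carry-< m v yq z = m%n<n ((yq + z % v) / v + z / v) m

subZ-digits⇔ : ∀ m v .{{_ : NonZero m}} .{{_ : NonZero v}} {yp yq r r′ z} →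
               yp < v → yq < v → r < m → r′ < m → z < m * v →
               (z ≡ subZ (m * v) (yp + v * r) (yq + v * r′)) ⇔ (z % v ≡ subZ v yp yq × subZ m r r′ ≡ carry m v yq z)
subZ-digits⇔ m v {yp} {yq} {r} {r′} {z} yp<v yq<v r<m r′<m z<mv =
  ⇔.trans sum⇔ (⇔.trans (digits-≡⇔ v (m%n<n (yq + z % v) v) yp<v) (low⇔ ×-⇔ high⇔))
  where
  open ≡-Reasoning
  instance
    mv≢0 : NonZero (m * v)
    mv≢0 = m*n≢0 m v
  low high : ℕ
  low  = (yq + z % v) % v
  high = ((yq + z % v) / v + (r′ + z / v)) % m
  sum-digits : (yq + v * r′ + z) % (m * v) ≡ low + v * high
  sum-digits = begin
    (yq + v * r′ + z) % (m * v)                   ≡⟨ cong (λ x → (yq + v * r′ + x) % (m * v)) (m≡m%n+[m/n]*n z v) ⟩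
    (yq + v * r′ + (z % v + z / v * v)) % (m * v) ≡⟨ cong (_% (m * v)) (solve 5 (λ yq v r′ s q → yq :+ v :* r′ :+ (s :+ q :* v) := yq :+ s :+ v :* (r′ :+ q)) refl yq v r′ (z % v) (z / v)) ⟩
    (yq + z % v + v * (r′ + z / v)) % (m * v)     ≡⟨ digits-% m v (yq + z % v) (r′ + z / v) ⟩
    low + v * high                                ∎
  sum⇔ : (z ≡ subZ (m * v) (yp + v * r) (yq + v * r′)) ⇔ (low + v * high ≡ yp + v * r)
  sum⇔ = ⇔.trans (subZ-spec (m * v) (digits-< m v yp<v r<m) (digits-< m v yq<v r′<m) z<mv) (≡-trans-⇔ sum-digits)
  low⇔ : (low ≡ yp) ⇔ (z % v ≡ subZ v yp yq)
  low⇔ = ⇔.sym (subZ-spec v yp<v yq<v (m%n<n z v))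
  high≡ : high ≡ (r′ + carry m v yq z) % m
  high≡ = begin
    ((yq + z % v) / v + (r′ + z / v)) % m       ≡⟨ cong (_% m) (solve 3 (λ c r′ w → c :+ (r′ :+ w) := r′ :+ (c :+ w)) refl ((yq + z % v) / v) r′ (z / v)) ⟩
    (r′ + ((yq + z % v) / v + z / v)) % m       ≡⟨ %-absorbʳ r′ _ m ⟨
    (r′ + carry m v yq z) % m                   ∎
  high⇔ : (high ≡ r) ⇔ (subZ m r r′ ≡ carry m v yq z)
  high⇔ = ⇔.trans (≡-trans-⇔ high≡) (⇔.trans (⇔.sym (subZ-spec m r<m r′<m (carry-< m v yq z))) ≡-sym-⇔)

numbered : ℕ → List A → List (ℕ × A)
numbered n []       = []
numbered n (x ∷ xs) = (n , x) ∷ numbered (suc n) xs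

map-proj₂-numbered : ∀ n (xs : List A) → map proj₂ (numbered n xs) ≡ xs
map-proj₂-numbered n []       = refl
map-proj₂-numbered n (x ∷ xs) = cong (x ∷_) (map-proj₂-numbered (suc n) xs)

length-numbered : ∀ n (xs : List A) → length (numbered n xs) ≡ length xs
length-numbered n xs = trans (sym (length-map proj₂ (numbered n xs))) (cong length (map-proj₂-numbered n xs))

∈-numbered : ∀ n (xs : List A) {i x} → (i , x) ∈ numbered n xs → n ≤ i × i < n + length xs × x ∈ xs
∈-numbered n (x ∷ xs) (here refl) = ≤-refl , m<m+n n (s≤s z≤n) , here refl
∈-numbered n (x ∷ xs) (there ∈ns) with ∈-numbered (suc n) xs ∈ns
... | n<i , i<n+xs , x∈xs = <⇒≤ n<i , <-≤-trans i<n+xs (≤-reflexive (sym (+-suc n (length xs)))) , there x∈xs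

numbered-index⇔ : ∀ n (xs : List A) {i j x y} → Unique xs → (i , x) ∈ numbered n xs → (j , y) ∈ numbered n xs →
                  (i ≡ j) ⇔ (x ≡ y)
numbered-index⇔ n (z ∷ xs) _ (here refl) (here refl) = mk⇔ (λ _ → refl) (λ _ → refl)
numbered-index⇔ n (z ∷ xs) uniq (here refl) (there ∈ns) with ∈-numbered (suc n) xs ∈ns
... | n<j , _ , y∈xs = mk⇔ (λ { refl → ⊥-elim (<-irrefl refl n<j) }) (λ { refl → ⊥-elim (Uniqueₚ.Unique[x∷xs]⇒x∉xs uniq y∈xs) })
numbered-index⇔ n (z ∷ xs) uniq (there ∈ns) (here refl) with ∈-numbered (suc n) xs ∈ns
... | n<i , _ , x∈xs = mk⇔ (λ { refl → ⊥-elim (<-irrefl refl n<i) }) (λ { refl → ⊥-elim (Uniqueₚ.Unique[x∷xs]⇒x∉xs uniq x∈xs) })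
numbered-index⇔ n (z ∷ xs) (_ ∷ u) (there ∈ns₁) (there ∈ns₂) = numbered-index⇔ (suc n) xs u ∈ns₁ ∈ns₂

kmax-≥ : ∀ {k} K → k ∈ K → k ≤ kmax K
kmax-≥ (k ∷ K) (here refl) = m≤m⊔n k (kmax K)
kmax-≥ (k ∷ K) (there k′∈) = ≤-trans (kmax-≥ K k′∈) (m≤n⊔m k (kmax K))

divN-lift-∣⇔ : ∀ m {v h} .{{_ : NonZero m}} .{{_ : NonZero v}} → 1 ≤ v → h ∣ v → ∀ z →
               (divN (m * v) (m * h) ∣ z) ⇔ (divN v h ∣ z % v)
divN-lift-∣⇔ m {h = h} 1≤v (divides w refl) z =
  subst₂ (λ a b → (a ∣ z) ⇔ (b ∣ z % (w * h))) (sym divN-mv) (sym divN-v)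
    (mk⇔ (λ w∣z → %-presˡ-∣ w∣z (m∣m*n h)) (∣n∣m%n⇒∣m (m∣m*n h)))
  where
  1≤h : 1 ≤ h
  1≤h = 1≤*⇒1≤ʳ w h 1≤v
  divN-v : divN (w * h) h ≡ w
  divN-v = divN-* w h 1≤h
  divN-mv : divN (m * (w * h)) (m * h) ≡ w
  divN-mv = trans (cong (λ n → divN n (m * h)) (solve 3 (λ m w h → m :* (w :* h) := w :* (m :* h)) refl m w h))
                  (divN-* w (m * h) (*-mono-≤ (>-nonZero⁻¹ m) 1≤h))

module Lift {u v g h : ℕ} {K : List ℕ} (m : ℕ) (P : ProperBDP u v g h K) (D : CDM m (kmax K)) where
  open ProperBDP P
  private
    k : ℕ
    k = kmax K
    instance
      m≢0 : NonZero m
      m≢0 = >-nonZero (CDM.m-pos D)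
      v≢0 : NonZero v
      v≢0 = >-nonZero v-pos

  -- Indices beyond the height of the matrix get a dummy row; blocks are never that long.
  row : ℕ → Fin m → ℕ
  row i l with i <? k
  ... | yes i<k = CDM.entry D (fromℕ< i<k) l
  ... | no  _   = 0

  row-< : ∀ i l → row i l < m
  row-< i l with i <? k
  ... | yes _ = CDM.entry<m D _ l
  ... | no  _ = CDM.m-pos D

  row-fromℕ< : ∀ {i} l (i<k : i < k) → row i l ≡ CDM.entry D (fromℕ< i<k) l
  row-fromℕ< {i} l i<k with i <? k
  ... | yes i<k′ = cong (λ p → CDM.entry D (fromℕ< p) l) (<-irrelevant i<k′ i<k)
  ... | no  i≮k  = ⊥-elim (i≮k i<k)

  row-diff : ∀ {i j w} → i < k → j < k → i ≢ j → w < m →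
             ∑ (λ l → 𝟙 (subZ m (row i l) (row j l) ≟ w)) (allFin m) ≡ 1
  row-diff {i} {j} {w} i<k j<k i≢j w<m = begin
    ∑ (λ l → 𝟙 (subZ m (row i l) (row j l) ≟ w)) (allFin m)  ≡⟨ ∑-cong (allFin m) (λ {l} _ → cong (λ x → 𝟙 (x ≟ w)) (cong₂ (subZ m) (row-fromℕ< l i<k) (row-fromℕ< l j<k))) ⟩
    ∑ (λ l → 𝟙 (d l ≟ w)) (allFin m)                         ≡⟨ ∑-map (λ x → 𝟙 (x ≟ w)) d (allFin m) ⟨
    ∑ (λ x → 𝟙 (x ≟ w)) (map d (allFin m))                   ≡⟨ length-filter≡∑𝟙 (_≟ w) (map d (allFin m)) ⟨
    length (filter (_≟ w) (map d (allFin m)))                ≡⟨ CDM.diffRow D _ _ fromℕ<-≢ w w<m ⟩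
    1                                                        ∎
    where
    open ≡-Reasoning
    d : Fin m → ℕ
    d l = subZ m (CDM.entry D (fromℕ< i<k) l) (CDM.entry D (fromℕ< j<k) l)
    fromℕ<-≢ : fromℕ< i<k ≢ fromℕ< j<k
    fromℕ<-≢ eq = i≢j (trans (sym (toℕ-fromℕ< i<k)) (trans (cong toℕ eq) (toℕ-fromℕ< j<k)))

  liftPoint : Fin m → ℕ × Elt → Elt
  liftPoint l (i , (x , y)) = (x , y + v * row i l)

  liftBlock : Fin m → List Elt → List Elt
  liftBlock l B = map (liftPoint l) (numbered 0 B)

  reduce : Elt → Elt
  reduce (x , z) = (x , z % v)

  reduce-liftPoint : ∀ l i {p} → InG u v p → reduce (liftPoint l (i , p)) ≡ p
  reduce-liftPoint l i {x , y} (_ , y<v) = cong (x ,_) (begin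
    (y + v * row i l) % v   ≡⟨ cong (λ n → (y + n) % v) (*-comm v (row i l)) ⟩
    (y + row i l * v) % v   ≡⟨ [m+kn]%n≡m%n y (row i l) v ⟩
    y % v                   ≡⟨ m<n⇒m%n≡m y<v ⟩
    y                       ∎)
    where open ≡-Reasoning

  liftPoint-InG : ∀ l i {p} → InG u v p → InG u (m * v) (liftPoint l (i , p))
  liftPoint-InG l i (x<u , y<v) = x<u , digits-< m v y<v (row-< i l)

  liftPoint-diff⇔ : ∀ l i j {p q e} → InG u v p → InG u v q → InG u (m * v) e →
                    (e ≡ subG u (m * v) (liftPoint l (i , p)) (liftPoint l (j , q))) ⇔
                    (reduce e ≡ subG u v p q × subZ m (row i l) (row j l) ≡ carry m v (proj₂ q) (proj₂ e))
  liftPoint-diff⇔ l i j {xp , yp} {xq , yq} {x , z} (_ , yp<v) (_ , yq<v) (_ , z<mv) = mk⇔ to from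
    where
    r r′ : ℕ
    r = row i l
    r′ = row j l
    digits : (z ≡ subZ (m * v) (yp + v * r) (yq + v * r′)) ⇔ (z % v ≡ subZ v yp yq × subZ m r r′ ≡ carry m v yq z)
    digits = subZ-digits⇔ m v yp<v yq<v (row-< i l) (row-< j l) z<mv
    to : (x , z) ≡ (subZ u xp xq , subZ (m * v) (yp + v * r) (yq + v * r′)) →
         (x , z % v) ≡ (subZ u xp xq , subZ v yp yq) × subZ m r r′ ≡ carry m v yq z
    to eq = cong₂ _,_ (,-injectiveˡ eq) (proj₁ (Equivalence.to digits (,-injectiveʳ eq))) , proj₂ (Equivalence.to digits (,-injectiveʳ eq))
    from : (x , z % v) ≡ (subZ u xp xq , subZ v yp yq) × subZ m r r′ ≡ carry m v yq z →
           (x , z) ≡ (subZ u xp xq , subZ (m * v) (yp + v * r) (yq + v * r′))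
    from (eq , high) = cong₂ _,_ (,-injectiveˡ eq) (Equivalence.from digits (,-injectiveʳ eq , high))

  ∑-𝟙-liftPoint-diff : ∀ {i j p q e} → i < k → j < k → i ≢ j → InG u v p → InG u v q → InG u (m * v) e →
                        ∑ (λ l → 𝟙 (e ≟E subG u (m * v) (liftPoint l (i , p)) (liftPoint l (j , q)))) (allFin m)
                          ≡ 𝟙 (reduce e ≟E subG u v p q)
  ∑-𝟙-liftPoint-diff {i} {j} {p} {q} {e} i<k j<k i≢j p∈G q∈G e∈G = begin
    ∑ (λ l → 𝟙 (e ≟E subG u (m * v) (liftPoint l (i , p)) (liftPoint l (j , q)))) (allFin m)
      ≡⟨ ∑-cong (allFin m) (λ {l} _ → 𝟙-split l) ⟩
    ∑ (λ l → 𝟙 low? * 𝟙 (high? l)) (allFin m)  ≡⟨ ∑-*ˡ (𝟙 low?) (λ l → 𝟙 (high? l)) (allFin m) ⟩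
    𝟙 low? * ∑ (λ l → 𝟙 (high? l)) (allFin m)  ≡⟨ cong (𝟙 low? *_) (row-diff i<k j<k i≢j (carry-< m v (proj₂ q) (proj₂ e))) ⟩
    𝟙 low? * 1                                 ≡⟨ *-identityʳ (𝟙 low?) ⟩
    𝟙 low?                                     ∎
    where
    open ≡-Reasoning
    low? : Dec (reduce e ≡ subG u v p q)
    low? = reduce e ≟E subG u v p q
    high? : ∀ l → Dec (subZ m (row i l) (row j l) ≡ carry m v (proj₂ q) (proj₂ e))
    high? l = subZ m (row i l) (row j l) ≟ carry m v (proj₂ q) (proj₂ e)
    𝟙-split : ∀ l → 𝟙 (e ≟E subG u (m * v) (liftPoint l (i , p)) (liftPoint l (j , q))) ≡ 𝟙 low? * 𝟙 (high? l)
    𝟙-split l = trans (𝟙-cong (Equivalence.to (liftPoint-diff⇔ l i j p∈G q∈G e∈G))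
                              (Equivalence.from (liftPoint-diff⇔ l i j p∈G q∈G e∈G)) _ (low? ×-dec high? l))
                      (𝟙-×-dec low? (high? l))

  ∑-diffOcc-liftPoint : ∀ {i j p q e} → i < k → j < k → (i ≡ j) ⇔ (p ≡ q) →
                        InG u v p → InG u v q → InG u (m * v) e →
                        ∑ (λ l → diffOcc u (m * v) e (liftPoint l (i , p)) (liftPoint l (j , q))) (allFin m)
                          ≡ diffOcc u v (reduce e) p q
  ∑-diffOcc-liftPoint {i} {j} {p} {q} {e} i<k j<k i≡j⇔p≡q p∈G q∈G e∈G = by-cases (p ≟E q)
    where
    by-cases : Dec (p ≡ q) → ∑ (λ l → diffOcc u (m * v) e (liftPoint l (i , p)) (liftPoint l (j , q))) (allFin m)
                               ≡ diffOcc u v (reduce e) p q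
    by-cases (yes p≡q) = trans
      (∑-zero (allFin m) λ {l} _ → diffOcc-≡ u (m * v) e (cong₂ (λ i p → liftPoint l (i , p)) (Equivalence.from i≡j⇔p≡q p≡q) p≡q))
      (sym (diffOcc-≡ u v (reduce e) p≡q))
    by-cases (no p≢q) = trans
      (∑-cong (allFin m) λ {l} _ → diffOcc-≢ u (m * v) e (lifted-≢ l))
      (trans (∑-𝟙-liftPoint-diff i<k j<k (p≢q ∘′ Equivalence.to i≡j⇔p≡q) p∈G q∈G e∈G) (sym (diffOcc-≢ u v (reduce e) p≢q)))
      where
      lifted-≢ : ∀ l → liftPoint l (i , p) ≢ liftPoint l (j , q)
      lifted-≢ l eq = p≢q (trans (sym (reduce-liftPoint l i p∈G)) (trans (cong reduce eq) (reduce-liftPoint l j q∈G)))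

  ∑-occ-liftBlock : ∀ {B e} → B ∈ blocks → InG u (m * v) e →
                    ∑ (λ l → occ e (Δ u (m * v) (liftBlock l B))) (allFin m) ≡ occ (reduce e) (Δ u v B)
  ∑-occ-liftBlock {B} {e} B∈ e∈G = begin
    ∑ (λ l → occ e (Δ u (m * v) (liftBlock l B))) (allFin m)
      ≡⟨ ∑-cong (allFin m) (λ {l} _ → occ-Δ-map u (m * v) e (liftPoint l) Z) ⟩
    ∑ (λ l → ∑ (λ a → ∑ (λ b → δ l a b) Z) Z) (allFin m)
      ≡⟨ ∑-comm (λ l a → ∑ (δ l a) Z) (allFin m) Z ⟩
    ∑ (λ a → ∑ (λ l → ∑ (δ l a) Z) (allFin m)) Z
      ≡⟨ ∑-cong Z (λ {a} _ → ∑-comm (λ l → δ l a) (allFin m) Z) ⟩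
    ∑ (λ a → ∑ (λ b → ∑ (λ l → δ l a b) (allFin m)) Z) Z
      ≡⟨ ∑-cong Z (λ a∈ → ∑-cong Z λ b∈ → pair a∈ b∈) ⟩
    ∑ (λ a → ∑ (λ b → diffOcc u v (reduce e) (proj₂ a) (proj₂ b)) Z) Z
      ≡⟨ occ-Δ-map u v (reduce e) proj₂ Z ⟨
    occ (reduce e) (Δ u v (map proj₂ Z))
      ≡⟨ cong (λ B → occ (reduce e) (Δ u v B)) (map-proj₂-numbered 0 B) ⟩
    occ (reduce e) (Δ u v B) ∎
    where
    open ≡-Reasoning
    Z : List (ℕ × Elt)
    Z = numbered 0 B
    δ : Fin m → ℕ × Elt → ℕ × Elt → ℕ
    δ l a b = diffOcc u (m * v) e (liftPoint l a) (liftPoint l b)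
    index-< : ∀ {i p} → (i , p) ∈ Z → i < k
    index-< ip∈ = ≤-trans (proj₁ (proj₂ (∈-numbered 0 B ip∈))) (kmax-≥ K (lookup block-size B∈))
    point-InG : ∀ {i p} → (i , p) ∈ Z → InG u v p
    point-InG ip∈ = lookup (lookup block-elts B∈) (proj₂ (proj₂ (∈-numbered 0 B ip∈)))
    pair : ∀ {a b} → a ∈ Z → b ∈ Z → ∑ (λ l → δ l a b) (allFin m) ≡ diffOcc u v (reduce e) (proj₂ a) (proj₂ b)
    pair a∈ b∈ = ∑-diffOcc-liftPoint (index-< a∈) (index-< b∈) (numbered-index⇔ 0 B (lookup block-set B∈) a∈ b∈)
                   (point-InG a∈) (point-InG b∈) e∈G

  liftedBlocks : List (List Elt)
  liftedBlocks = concatMap (λ B → map (λ l → liftBlock l B) (allFin m)) blocks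

  All-liftedBlocks : ∀ {Q : List Elt → Set} → (∀ {B} → B ∈ blocks → ∀ l → Q (liftBlock l B)) → All Q liftedBlocks
  All-liftedBlocks Q-lift = Allₚ.concat⁺ (Allₚ.map⁺ (tabulate λ B∈ → Allₚ.map⁺ (tabulate λ {l} _ → Q-lift B∈ l)))

  length-liftBlock : ∀ l B → length (liftBlock l B) ≡ length B
  length-liftBlock l B = trans (length-map (liftPoint l) (numbered 0 B)) (length-numbered 0 B)

  map-reduce-liftBlock : ∀ l n B → All (InG u v) B → map reduce (map (liftPoint l) (numbered n B)) ≡ B
  map-reduce-liftBlock l n []      []            = refl
  map-reduce-liftBlock l n (p ∷ B) (p∈G ∷ B⊆G) = cong₂ _∷_ (reduce-liftPoint l n p∈G) (map-reduce-liftBlock l (suc n) B B⊆G)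

  numBlocks-lifted : ∀ k′ → numBlocks k′ liftedBlocks ≡ m * numBlocks k′ blocks
  numBlocks-lifted k′ = begin
    numBlocks k′ liftedBlocks                                        ≡⟨ numBlocks≡∑ k′ liftedBlocks ⟩
    ∑ (λ B′ → 𝟙 (length B′ ≟ k′)) liftedBlocks                       ≡⟨ ∑-concatMap _ _ blocks ⟩
    ∑ (λ B → ∑ (λ B′ → 𝟙 (length B′ ≟ k′)) (map (λ l → liftBlock l B) (allFin m))) blocks
                                                                     ≡⟨ ∑-cong blocks (λ {B} _ → copies B) ⟩
    ∑ (λ B → m * 𝟙 (length B ≟ k′)) blocks                          ≡⟨ ∑-*ˡ m _ blocks ⟩
    m * ∑ (λ B → 𝟙 (length B ≟ k′)) blocks                          ≡⟨ cong (m *_) (numBlocks≡∑ k′ blocks) ⟨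
    m * numBlocks k′ blocks                                          ∎
    where
    open ≡-Reasoning
    copies : ∀ B → ∑ (λ B′ → 𝟙 (length B′ ≟ k′)) (map (λ l → liftBlock l B) (allFin m)) ≡ m * 𝟙 (length B ≟ k′)
    copies B = begin
      ∑ (λ B′ → 𝟙 (length B′ ≟ k′)) (map (λ l → liftBlock l B) (allFin m))  ≡⟨ ∑-map _ (λ l → liftBlock l B) (allFin m) ⟩
      ∑ (λ l → 𝟙 (length (liftBlock l B) ≟ k′)) (allFin m)                  ≡⟨ ∑-cong (allFin m) (λ {l} _ → cong (λ n → 𝟙 (n ≟ k′)) (length-liftBlock l B)) ⟩
      ∑ (λ _ → 𝟙 (length B ≟ k′)) (allFin m)                                ≡⟨ ∑-const _ (allFin m) ⟩
      length (allFin m) * 𝟙 (length B ≟ k′)                                 ≡⟨ cong (_* 𝟙 (length B ≟ k′)) (length-tabulate {n = m} id) ⟩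
      m * 𝟙 (length B ≟ k′)                                                 ∎

  leave-lifted : HasLeave u (m * v) g (m * h) (allDiffs u (m * v) liftedBlocks)
  leave-lifted e@(x , z) e∈G@(x<u , _) = begin
    occ e (allDiffs u (m * v) liftedBlocks)                               ≡⟨ occ-allDiffs u (m * v) e liftedBlocks ⟩
    ∑ (λ B′ → occ e (Δ u (m * v) B′)) liftedBlocks                        ≡⟨ ∑-concatMap _ _ blocks ⟩
    ∑ (λ B → ∑ (λ B′ → occ e (Δ u (m * v) B′)) (map (λ l → liftBlock l B) (allFin m))) blocks
                                                                          ≡⟨ ∑-cong blocks (λ {B} B∈ → trans (∑-map _ (λ l → liftBlock l B) (allFin m)) (∑-occ-liftBlock B∈ e∈G)) ⟩
    ∑ (λ B → occ (reduce e) (Δ u v B)) blocks                             ≡⟨ occ-allDiffs u v (reduce e) blocks ⟨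
    occ (reduce e) (allDiffs u v blocks)                                  ≡⟨ leave (reduce e) (x<u , m%n<n z v) ⟩
    𝟙 (¬? (InH? u v g h (reduce e)))                                      ≡⟨ 𝟙-cong (_∘′ Equivalence.to InH⇔) (_∘′ Equivalence.from InH⇔) _ _ ⟩
    𝟙 (¬? (InH? u (m * v) g (m * h) e))                                   ∎
    where
    open ≡-Reasoning
    InH⇔ : InH u (m * v) g (m * h) e ⇔ InH u v g h (reduce e)
    InH⇔ = ⇔.refl ×-⇔ divN-lift-∣⇔ m v-pos t∣v z

  lifted : ProperBDP u (m * v) g (m * h) K
  lifted = record
    { u-pos      = u-pos
    ; v-pos      = *-mono-≤ (CDM.m-pos D) v-pos
    ; s∣u        = s∣u
    ; t∣v        = *-monoʳ-∣ m t∣v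
    ; blocks     = liftedBlocks
    ; block-elts = All-liftedBlocks λ {B} B∈ l → Allₚ.map⁺ (tabulate λ {(i , p)} ip∈ →
                     liftPoint-InG l i (lookup (lookup block-elts B∈) (proj₂ (proj₂ (∈-numbered 0 B ip∈)))))
    ; block-set  = All-liftedBlocks λ {B} B∈ l → Uniqueₚ.map⁻ (subst Unique
                     (sym (map-reduce-liftBlock l 0 B (lookup block-elts B∈))) (lookup block-set B∈))
    ; block-size = All-liftedBlocks λ {B} B∈ l → subst (_∈ K) (sym (length-liftBlock l B)) (lookup block-size B∈)
    ; block-big  = All-liftedBlocks λ {B} B∈ l → subst (2 ≤_) (sym (length-liftBlock l B)) (lookup block-big B∈)
    ; balanced   = λ {k} {k′} k∈ k′∈ 2≤k 2≤k′ → trans (numBlocks-lifted k)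
                     (trans (cong (m *_) (balanced k∈ k′∈ 2≤k 2≤k′)) (sym (numBlocks-lifted k′)))
    ; leave      = leave-lifted
    }

corollary3p6 : (K : List ℕ) → K ≢ [] → All (1 ≤_) K →
    (u v g h m s t : ℕ) → BDP u v g h K → CDM m (kmax K) →
      ((BDP g (m * h) s t K → BDP u (m * v) s t K × BDP u (m * v) g (m * h) K)
      × (BDP (m * g) h s t K → BDP (m * u) v s t K × BDP (m * u) v (m * g) h K))
corollary3p6 K _ 1≤K u v g h m s t P D = extend-vertically , extend-horizontally
  where
  vertical : ProperBDP u (m * v) g (m * h) K
  vertical = Lift.lifted m (BDP→ProperBDP P) D
  horizontal : ProperBDP v (m * u) h (m * g) K
  horizontal = Lift.lifted m (swapProperBDP (BDP→ProperBDP P)) D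
  extend-vertically : BDP g (m * h) s t K → BDP u (m * v) s t K × BDP u (m * v) g (m * h) K
  extend-vertically F = ProperBDP→BDP 1≤K (fill vertical (BDP→ProperBDP F)) , ProperBDP→BDP 1≤K vertical
  extend-horizontally : BDP (m * g) h s t K → BDP (m * u) v s t K × BDP (m * u) v (m * g) h K
  extend-horizontally F =
    ProperBDP→BDP 1≤K (swapProperBDP (fill horizontal (swapProperBDP (BDP→ProperBDP F)))) ,
    ProperBDP→BDP 1≤K (swapProperBDP horizontal)
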